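{- Let $a\in\mathbb{N}$ with $a\geq 3$, and let $S(a)$ be the submonoid of $(\mathbb{N},+)$ generated by $\{f_a+f_n\mid n\in\mathbb{N}\}$. Then the embedding dimension of $S(a)$ is $\mathrm{e}(S(a))=a-1$.
   Context: $\{f_n\}$ is the Fibonacci sequence ($f_0=0$, $f_1=1$, $f_{n+2}=f_{n+1}+f_n$). The embedding dimension of a numerical semigroup is the cardinality of its (unique) minimal system of generators. -}

module Defs where

open import Data.Nat using (ℕ; zero; suc; _+_)
open import Data.Product using (∃; _×_; _,_)
open import Data.List using (List; length)
open import Data.List.Membership.Propositional using (_∈_)
open import Data.List.Relation.Unary.Unique.Propositional using (Unique)
open import Relation.Binary.PropositionalEquality using (_≡_)
open import Relation.Nullary using (¬_)
open import Function.Bundles using (_⇔_)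

fib : ℕ → ℕ
fib 0 = 0
fib 1 = 1
fib (suc (suc n)) = fib (suc n) + fib n

data Generated (G : ℕ → Set) : ℕ → Set where
  gen-zero : Generated G 0
  gen-base : ∀ {x} → G x → Generated G x
  gen-add  : ∀ {x y} → Generated G x → Generated G y → Generated G (x + y)

FibGen : ℕ → ℕ → Set
FibGen a x = ∃ λ n → x ≡ fib a + fib n

S : ℕ → ℕ → Set
S a = Generated (FibGen a)

-- The (unique) minimal system of generators of a submonoid M of ℕ is
-- M* \ (M* + M*), where M* = M \ {0}.
MinimalGenerator : (ℕ → Set) → ℕ → Set
MinimalGenerator M x =
  M x × ¬ (x ≡ 0) ×
  ¬ (∃ λ y → ∃ λ z → M y × ¬ (y ≡ 0) × M z × ¬ (z ≡ 0) × x ≡ y + z)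

-- The embedding dimension of M is e: the minimal system of generators of M
-- is a finite set of cardinality e (listed without repetition).
EmbeddingDimension : (ℕ → Set) → ℕ → Set
EmbeddingDimension M e =
  ∃ λ (L : List ℕ) → Unique L × length L ≡ e × (∀ x → (x ∈ L) ⇔ MinimalGenerator M x)

{-# OPTIONS --safe #-}
-- Every generator f_a + f_n is at least c = f_a, so every nonzero element of S(a) is at least c
-- and every generator below 2c is a minimal generator.  Conversely f_n lies in S(a) for n ≥ a:
-- f_a = c + f_0 and f_(a+1) = c + f_(a-1) are generators, and the Fibonacci recurrence does the
-- rest.  So c + f_n is a sum of two nonzero elements once n ≥ a, and the minimal generators are
-- the values c + f_n with n < a, of which there are a - 1 because f_1 = f_2.
module Submission where

open import Defs
open import Data.Nat using (ℕ; zero; suc; _+_; _∸_; _≤_; _<_; _≟_; _<?_; z≤n; s≤s)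
open import Data.Nat.Properties
open import Data.Product using (∃; _×_; _,_; map₂)
open import Data.Empty using (⊥-elim)
open import Data.Sum using (inj₁; inj₂)
open import Data.List using (map; upTo)
open import Data.List.Properties using (length-map; length-upTo)
open import Data.List.Membership.Propositional using (_∈_)
open import Data.List.Membership.Propositional.Properties using (∈-map⁺; ∈-map⁻; ∈-upTo⁺; ∈-upTo⁻)
open import Data.List.Relation.Unary.Unique.Propositional.Properties using (map⁺; upTo⁺)
open import Relation.Binary.PropositionalEquality
open import Relation.Binary using (tri<; tri≈; tri>)
open import Relation.Nullary using (¬_; yes; no)
open import Function.Base using (_∘_)
open import Function.Bundles using (_⇔_; mk⇔; Equivalence)
open import Function.Definitions using (Injective)

Decomposable : (ℕ → Set) → ℕ → Set
Decomposable M x = ∃ λ y → ∃ λ z → M y × ¬ (y ≡ 0) × M z × ¬ (z ≡ 0) × x ≡ y + z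

embeddingDimension-enumerated : ∀ {M n} (f : ℕ → ℕ) → Injective _≡_ _≡_ f →
  (∀ {x} → MinimalGenerator M x ⇔ (∃ λ k → k < n × x ≡ f k)) → EmbeddingDimension M n
embeddingDimension-enumerated {M} {n} f f-injective minimal⇔ =
  map f (upTo n) , map⁺ f-injective (upTo⁺ n) ,
  trans (length-map f (upTo n)) (length-upTo n) , λ x → mk⇔ enumerated⇒minimal minimal⇒enumerated
  where
  enumerated⇒minimal : ∀ {x} → x ∈ map f (upTo n) → MinimalGenerator M x
  enumerated⇒minimal x∈ with k , k∈ , x≡fk ← ∈-map⁻ f x∈ =
    Equivalence.from minimal⇔ (k , ∈-upTo⁻ k∈ , x≡fk)

  minimal⇒enumerated : ∀ {x} → MinimalGenerator M x → x ∈ map f (upTo n)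
  minimal⇒enumerated min with k , k<n , refl ← Equivalence.to minimal⇔ min = ∈-map⁺ f (∈-upTo⁺ k<n)

module _ {G : ℕ → Set} where

  indecomposable⇒generator : ∀ {x} → Generated G x → ¬ x ≡ 0 → ¬ Decomposable (Generated G) x → G x
  indecomposable⇒generator gen-zero 0≢0 _ = ⊥-elim (0≢0 refl)
  indecomposable⇒generator (gen-base g) _ _ = g
  indecomposable⇒generator (gen-add {y} {z} My Mz) y+z≢0 indecomposable with y ≟ 0 | z ≟ 0
  ... | yes refl | _ = indecomposable⇒generator Mz y+z≢0 indecomposable
  ... | no y≢0 | yes refl = subst G (sym (+-identityʳ y)) (indecomposable⇒generator My y≢0
    (indecomposable ∘ subst (Decomposable (Generated G)) (sym (+-identityʳ y))))
  ... | no y≢0 | no z≢0 = ⊥-elim (indecomposable (y , z , My , y≢0 , Mz , z≢0 , refl))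

  minimal⇒generator : ∀ {x} → MinimalGenerator (Generated G) x → G x
  minimal⇒generator (Mx , x≢0 , indecomposable) = indecomposable⇒generator Mx x≢0 indecomposable

module _ {G : ℕ → Set} {c : ℕ} (generators-≥ : ∀ {y} → G y → c ≤ y) where

  nonzero⇒≥ : ∀ {x} → Generated G x → ¬ x ≡ 0 → c ≤ x
  nonzero⇒≥ gen-zero 0≢0 = ⊥-elim (0≢0 refl)
  nonzero⇒≥ (gen-base g) _ = generators-≥ g
  nonzero⇒≥ (gen-add {y} {z} My Mz) y+z≢0 with y ≟ 0
  ... | yes refl = nonzero⇒≥ Mz y+z≢0
  ... | no y≢0 = ≤-trans (nonzero⇒≥ My y≢0) (m≤m+n y z)

  generator⇒minimal : ∀ {x} → G x → ¬ x ≡ 0 → x < c + c → MinimalGenerator (Generated G) x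
  generator⇒minimal g x≢0 x<2c = gen-base g , x≢0 , λ (y , z , My , y≢0 , Mz , z≢0 , x≡y+z) →
    <⇒≱ x<2c (subst (c + c ≤_) (sym x≡y+z) (+-mono-≤ (nonzero⇒≥ My y≢0) (nonzero⇒≥ Mz z≢0)))

0<fib[1+n] : ∀ n → 0 < fib (suc n)
0<fib[1+n] zero = s≤s z≤n
0<fib[1+n] (suc n) = ≤-trans (0<fib[1+n] n) (m≤m+n (fib (suc n)) (fib n))

-- The Fibonacci values without the repetition f_1 = f_2: 0, 1, 2, 3, 5, 8, …
distinctFib : ℕ → ℕ
distinctFib zero = 0
distinctFib (suc k) = fib (suc (suc k))

distinctFib-isFib : ∀ k → ∃ λ n → distinctFib k ≡ fib n
distinctFib-isFib zero = 0 , refl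
distinctFib-isFib (suc k) = suc (suc k) , refl

fib-isDistinctFib : ∀ n → ∃ λ k → fib n ≡ distinctFib k
fib-isDistinctFib zero = 0 , refl
fib-isDistinctFib (suc zero) = 1 , refl
fib-isDistinctFib (suc (suc n)) = suc n , refl

distinctFib-<-suc : ∀ k → distinctFib k < distinctFib (suc k)
distinctFib-<-suc zero = s≤s z≤n
distinctFib-<-suc (suc k) = m<m+n (fib (suc (suc k))) (0<fib[1+n] k)

distinctFib-mono-< : ∀ {k l} → k < l → distinctFib k < distinctFib l
distinctFib-mono-< {k} {suc l} k<1+l with m<1+n⇒m<n∨m≡n k<1+l
... | inj₁ k<l = <-trans (distinctFib-mono-< k<l) (distinctFib-<-suc l)
... | inj₂ refl = distinctFib-<-suc k

distinctFib-injective : Injective _≡_ _≡_ distinctFib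
distinctFib-injective {k} {l} eq with <-cmp k l
... | tri< k<l _ _ = ⊥-elim (<⇒≢ (distinctFib-mono-< k<l) eq)
... | tri≈ _ k≡l _ = k≡l
... | tri> _ _ l<k = ⊥-elim (>⇒≢ (distinctFib-mono-< l<k) eq)

-- Writing a = e + 2 makes c = distinctFib (suc e) and a ∸ 1 = suc e hold definitionally.
module FibonacciSemigroup (e : ℕ) where

  a c : ℕ
  a = suc (suc e)
  c = fib a

  0<c : 0 < c
  0<c = 0<fib[1+n] (suc e)

  FibGen-≥ : ∀ {y} → FibGen a y → c ≤ y
  FibGen-≥ (n , refl) = m≤m+n c (fib n)

  c∈S : S a c
  c∈S = gen-base (0 , sym (+-identityʳ c))

  distinctFib∈S : ∀ {k} → suc e ≤ k → S a (distinctFib k)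
  distinctFib∈S {suc k} (s≤s e≤k) =
    subst (λ i → S a (distinctFib (suc i))) (m∸n+n≡m e≤k) (from-e (k ∸ e))
    where
    from-e : ∀ m → S a (distinctFib (suc (m + e)))
    from-e zero = c∈S
    from-e (suc zero) = gen-base (suc e , refl)
    from-e (suc (suc m)) = gen-add (from-e (suc m)) (from-e m)

  c+distinctFib-decomposable : ∀ {k} → suc e ≤ k → Decomposable (S a) (c + distinctFib k)
  c+distinctFib-decomposable {suc k} 1+e≤k =
    c , distinctFib (suc k) , c∈S , n>0⇒n≢0 0<c ,
    distinctFib∈S 1+e≤k , n>0⇒n≢0 (0<fib[1+n] (suc k)) , refl

  minimalGenerator⇔ : ∀ {x} → MinimalGenerator (S a) x ⇔ (∃ λ k → k < suc e × x ≡ c + distinctFib k)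
  minimalGenerator⇔ = mk⇔ minimal⇒small small⇒minimal
    where
    minimal⇒small : ∀ {x} → MinimalGenerator (S a) x → ∃ λ k → k < suc e × x ≡ c + distinctFib k
    minimal⇒small min@(_ , _ , indecomposable) with minimal⇒generator min
    ... | n , refl with fib-isDistinctFib n
    ... | k , fn≡dk with k <? suc e
    ... | yes k<1+e = k , k<1+e , cong (c +_) fn≡dk
    ... | no k≮1+e = ⊥-elim (indecomposable
          (subst (Decomposable (S a)) (cong (c +_) (sym fn≡dk)) (c+distinctFib-decomposable (≮⇒≥ k≮1+e))))

    small⇒minimal : ∀ {x} → (∃ λ k → k < suc e × x ≡ c + distinctFib k) → MinimalGenerator (S a) x
    small⇒minimal (k , k<1+e , refl) =
      generator⇒minimal FibGen-≥ (map₂ (cong (c +_)) (distinctFib-isFib k))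
        (n>0⇒n≢0 (<-≤-trans 0<c (m≤m+n c (distinctFib k))))
        (+-monoʳ-< c (distinctFib-mono-< k<1+e))

  embeddingDimension : EmbeddingDimension (S a) (suc e)
  embeddingDimension = embeddingDimension-enumerated (λ k → c + distinctFib k)
    (distinctFib-injective ∘ +-cancelˡ-≡ c _ _) minimalGenerator⇔

corollary8 : (a : ℕ) → 3 ≤ a → EmbeddingDimension (S a) (a ∸ 1)
corollary8 (suc (suc (suc b))) (s≤s (s≤s (s≤s z≤n))) = FibonacciSemigroup.embeddingDimension (suc b)
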